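{- Let $G$ be a graph, let $\mathcal{P}=(P_1,\dots,P_r)$ be a partition of $V(G)$, and let $G'=G/\mathcal{P}$. For each $i\in[r]$ let $\Lambda_i$ be a linear order of $P_i$ whose mim-width in $G[P_i]$ is at most $c$, and suppose that $\mathrm{cutmim}_G(P_i,P_j)\le d$ for all distinct $i,j\in[r]$. Let $\Lambda=\Lambda_1,\Lambda_2,\dots,\Lambda_r$ (the concatenation, a linear order of $V(G)$), and let $\Lambda'=P_1,\dots,P_r$ be the corresponding linear order of $V(G')$. Then the mim-width of $\Lambda$ in $G$ is at most $2d\cdot\mathrm{cutw}(\Lambda')+c$.
   Context: For disjoint vertex sets $A,B$, $\mathrm{cutmim}_G(A,B)$ is the size of a maximum induced matching in the bipartite graph on $A\cup B$ formed by the edges of $G$ between $A$ and $B$. The mim-width of a linear order $v_1,\dots,v_n$ of $V(G)$ is $\max_i\mathrm{cutmim}_G(\{v_1,\dots,v_i\},\{v_{i+1},\dots,v_n\})$. The quotient graph $G/\mathcal{P}$ is obtained by contracting each part of $\mathcal{P}$ into a single vertex (two parts adjacent iff $G$ has an edge between them). The cutwidth $\mathrm{cutw}$ of a linear order $u_1,\dots,u_m$ of a graph is the maximum over $i$ of the number of edges with one endpoint in $\{u_1,\dots,u_i\}$ and the other in $\{u_{i+1},\dots,u_m\}$. -}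

module Defs where

open import Data.Nat using (ℕ; zero; suc; _≤_; _⊔_)
open import Data.Fin using (Fin)
open import Data.Fin.Properties using (any?) renaming (_≟_ to _≟ᶠ_)
open import Data.List using (List; length; take; drop; map; foldr; filter; cartesianProduct; upTo; concat)
open import Data.List.Relation.Unary.Unique.Propositional using (Unique)
open import Data.List.Membership.Propositional using (_∈_)
import Data.List.Membership.DecPropositional as DecMem
open import Data.List using (allFin)
open import Data.Product using (Σ; ∃; _×_; _,_; proj₁; proj₂)
open import Data.Empty using (⊥)
open import Relation.Nullary using (¬_; Dec)
open import Relation.Nullary.Decidable using (_×-dec_; ¬?)
open import Relation.Binary.PropositionalEquality using (_≡_; _≢_)
open import Relation.Binary using (Decidable)
open import Function.Bundles using (_⇔_)

record Graph (n : ℕ) : Set₁ where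
  field
    E     : Fin n → Fin n → Set
    E?    : Decidable E
    sym   : ∀ {u v} → E u v → E v u
    irrefl : ∀ {u} → ¬ E u u
open Graph public

record IsInducedMatching {n : ℕ} (G : Graph n) (A B : Fin n → Set)
                         {m : ℕ} (a b : Fin m → Fin n) : Set where
  field
    inA     : ∀ k → A (a k)
    inB     : ∀ k → B (b k)
    edge    : ∀ k → E G (a k) (b k)
    induced : ∀ k l → k ≢ l → ¬ E G (a k) (b l)

CutmimLe : {n : ℕ} → Graph n → (Fin n → Set) → (Fin n → Set) → ℕ → Set
CutmimLe {n} G A B w =
  ∀ (m : ℕ) (a b : Fin m → Fin n) → IsInducedMatching G A B a b → m ≤ w

MimWidthLe : {n : ℕ} → Graph n → List (Fin n) → ℕ → Set
MimWidthLe G Λ w = ∀ (t : ℕ) → CutmimLe G (_∈ take t Λ) (_∈ drop t Λ) w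

IsLinearOrderOf : {n : ℕ} → (Fin n → Set) → List (Fin n) → Set
IsLinearOrderOf S Λ = Unique Λ × (∀ v → (v ∈ Λ) ⇔ S v)

record Partition (n r : ℕ) : Set where
  field
    part     : Fin n → Fin r
    nonempty : ∀ (i : Fin r) → ∃ λ v → part v ≡ i
open Partition public

Part : {n r : ℕ} → Partition n r → Fin r → Fin n → Set
Part 𝒫 i v = part 𝒫 v ≡ i

QE : {n r : ℕ} → Graph n → Partition n r → Fin r → Fin r → Set
QE {n} G 𝒫 i j = (i ≢ j) × ∃ λ (u : Fin n) → ∃ λ (v : Fin n) →
                   (part 𝒫 u ≡ i) × (part 𝒫 v ≡ j) × E G u v

QE? : {n r : ℕ} (G : Graph n) (𝒫 : Partition n r) → Decidable (QE G 𝒫)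
QE? G 𝒫 i j =
  ¬? (i ≟ᶠ j) ×-dec
  any? (λ u → any? (λ v → (part 𝒫 u ≟ᶠ i) ×-dec ((part 𝒫 v ≟ᶠ j) ×-dec E? G u v)))

quotient : {n r : ℕ} → Graph n → Partition n r → Graph r
quotient G 𝒫 = record
  { E = QE G 𝒫
  ; E? = QE? G 𝒫
  ; sym = λ { (i≢j , u , v , pu , pv , e) →
              (λ eq → i≢j (symm eq)) , v , u , pv , pu , Graph.sym G e }
  ; irrefl = λ { (i≢i , _) → i≢i Relation.Binary.PropositionalEquality.refl }
  }
  where
  symm = Relation.Binary.PropositionalEquality.sym

-- Number of edges of H with one endpoint among the first t vertices of Λ and
-- the other among the remaining ones (counted as ordered pairs (u,v) with
-- u in the prefix and v in the suffix, i.e. each edge exactly once).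
crossingEdges : {m : ℕ} → Graph m → List (Fin m) → ℕ → ℕ
crossingEdges {m} H Λ t =
  length (filter (λ p → (proj₁ p ∈? take t Λ) ×-dec
                         ((proj₂ p ∈? drop t Λ) ×-dec E? H (proj₁ p) (proj₂ p)))
                 (cartesianProduct (allFin m) (allFin m)))
  where open DecMem (_≟ᶠ_ {m}) using (_∈?_)

cutw : {m : ℕ} → Graph m → List (Fin m) → ℕ
cutw H Λ = foldr _⊔_ 0 (map (crossingEdges H Λ) (upTo (suc (length Λ))))

-- Fix a cut of Λ = Λ₁ … Λᵣ. It falls inside one block Λᵢ, so every edge a – b
-- of an induced matching across it satisfies part a ≤ i ≤ part b. Edges with
-- both ends in Pᵢ form an induced matching across a cut of Λᵢ: at most c of
-- them. Every other edge maps to the quotient edge (part a , part b), which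
-- crosses the cut of Λ' just before or just after Pᵢ; the matching edges
-- mapped to one quotient edge (p , q) form an induced matching between Pₚ and
-- P_q, so there are at most d of them. Each of the two quotient cuts has at
-- most cutw(Λ') edges, giving 2 d cutw(Λ') + c.
module Submission where

open import Defs hiding (sym)
open import Data.Nat using (ℕ; zero; suc; _+_; _*_; _≤_; _<_; _⊔_; z≤n; s≤s)
open import Data.Nat.Properties
open import Data.Nat.Tactic.RingSolver using (solve-∀)
open import Data.Fin using (Fin; toℕ)
  renaming (zero to fzero; suc to fsuc; _≟_ to _≟ᶠ_; _≤_ to _≤ᶠ_; _<_ to _<ᶠ_)
import Data.Fin.Properties as Fin
open import Data.List
  using (List; []; _∷_; _++_; length; take; drop; concat; map; filter; foldr; lookup;
         tabulate; allFin; cartesianProduct)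
open import Data.List.Properties
  using (length-++; length-tabulate; map-tabulate; drop-[])
open import Data.List.Membership.Propositional using (_∈_)
open import Data.List.Membership.Propositional.Properties
  using (∈-++⁻; ∈-++⁺ˡ; ∈-++⁺ʳ; ∈-concat⁻′; ∈-tabulate⁺; ∈-tabulate⁻; ∈-filter⁺; ∈-filter⁻;
         ∈-cartesianProduct⁺; ∈-allFin; ∈-lookup; ∈-map⁺; ∈-upTo⁺)
import Data.List.Membership.DecPropositional as DecMembership
open import Data.List.Relation.Binary.Sublist.Propositional.Properties
  using (take-⊆; drop-⊆; Any-resp-⊆)
open import Data.List.Relation.Unary.Any using (here; there)
open import Data.List.Relation.Unary.All using (All)
import Data.List.Relation.Unary.All as All
open import Data.List.Relation.Unary.All.Properties using (all-filter)
open import Data.List.Relation.Unary.AllPairs using (_∷_)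
open import Data.List.Relation.Unary.Unique.Propositional using (Unique)
open import Data.List.Relation.Unary.Unique.Propositional.Properties using (filter⁺; allFin⁺)
open import Data.Product using (∃-syntax; _×_; _,_; proj₁; proj₂)
open import Data.Product.Properties using (≡-dec)
open import Data.Sum using (_⊎_; inj₁; inj₂; [_,_]′)
import Data.Sum as Sum
open import Function using (_∘_; id)
open import Function.Bundles using (Equivalence)
open import Relation.Nullary using (¬_; yes; no; contradiction)
open import Relation.Nullary.Decidable using (_×-dec_)
open import Relation.Unary using (Pred; Decidable)
open import Relation.Unary.Properties using (∁?)
open import Relation.Binary.Definitions using (DecidableEquality)
open import Relation.Binary.PropositionalEquality
  using (_≡_; _≢_; refl; sym; trans; cong; subst)
open import Level using (0ℓ)

module _ {X : Set} where

  take-++-≤ : ∀ t (xs ys : List X) → t ≤ length xs → take t (xs ++ ys) ≡ take t xs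
  take-++-≤ zero    xs       ys _         = refl
  take-++-≤ (suc t) (x ∷ xs) ys (s≤s t≤) = cong (x ∷_) (take-++-≤ t xs ys t≤)

  drop-++-≤ : ∀ t (xs ys : List X) → t ≤ length xs → drop t (xs ++ ys) ≡ drop t xs ++ ys
  drop-++-≤ zero    xs       ys _         = refl
  drop-++-≤ (suc t) (x ∷ xs) ys (s≤s t≤) = drop-++-≤ t xs ys t≤

  take-++-+ : ∀ u (xs ys : List X) → take (length xs + u) (xs ++ ys) ≡ xs ++ take u ys
  take-++-+ u []       ys = refl
  take-++-+ u (x ∷ xs) ys = cong (x ∷_) (take-++-+ u xs ys)

  drop-++-+ : ∀ u (xs ys : List X) → drop (length xs + u) (xs ++ ys) ≡ drop u ys
  drop-++-+ u []       ys = refl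
  drop-++-+ u (x ∷ xs) ys = drop-++-+ u xs ys

  ∈-take-tabulate : ∀ {r} (f : Fin r → X) {s} (j : Fin r) → toℕ j < s → f j ∈ take s (tabulate f)
  ∈-take-tabulate {suc r} f {suc s} fzero    _         = here refl
  ∈-take-tabulate {suc r} f {suc s} (fsuc j) (s≤s j<s) = there (∈-take-tabulate (f ∘ fsuc) j j<s)

  ∈-drop-tabulate : ∀ {r} (f : Fin r → X) {s} (j : Fin r) → s ≤ toℕ j → f j ∈ drop s (tabulate f)
  ∈-drop-tabulate         f {zero}  j        _         = ∈-tabulate⁺ j
  ∈-drop-tabulate {suc r} f {suc s} (fsuc j) (s≤s s≤j) = ∈-drop-tabulate (f ∘ fsuc) j s≤j

  ∈-concat-tabulate : ∀ {r} (Λs : Fin r → List X) {v} → v ∈ concat (tabulate Λs) → ∃[ j ] v ∈ Λs j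
  ∈-concat-tabulate Λs v∈ with xs , v∈xs , xs∈ ← ∈-concat⁻′ (tabulate Λs) v∈
                          with j , refl ← ∈-tabulate⁻ xs∈ = j , v∈xs

  record BlockCut {r} (Λs : Fin r → List X) (t : ℕ) : Set where
    field
      block  : Fin r
      offset : ℕ
      prefix : ∀ {v} → v ∈ take t (concat (tabulate Λs)) →
               (∃[ j ] j <ᶠ block × v ∈ Λs j) ⊎ v ∈ take offset (Λs block)
      suffix : ∀ {v} → v ∈ drop t (concat (tabulate Λs)) →
               (∃[ j ] block <ᶠ j × v ∈ Λs j) ⊎ v ∈ drop offset (Λs block)

  -- The element w of the suffix only serves to rule out r = 0.
  blockCut : ∀ {r} (Λs : Fin r → List X) t {w} → w ∈ drop t (concat (tabulate Λs)) → BlockCut Λs t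
  blockCut {zero} Λs t w∈ = contradiction (subst (_ ∈_) (drop-[] t) w∈) λ ()
  blockCut {suc r} Λs t w∈ with ≤-total t (length (Λs fzero))
  ... | inj₁ t≤ = record
    { block  = fzero
    ; offset = t
    ; prefix = λ v∈ → inj₂ (subst (_ ∈_) (take-++-≤ t (Λs fzero) rest t≤) v∈)
    ; suffix = λ v∈ → Sum.map₁ later
                 (Sum.swap (∈-++⁻ (drop t (Λs fzero)) (subst (_ ∈_) (drop-++-≤ t (Λs fzero) rest t≤) v∈)))
    }
    where
    rest : List X
    rest = concat (tabulate (Λs ∘ fsuc))
    later : ∀ {v} → v ∈ rest → ∃[ j ] fzero {r} <ᶠ j × v ∈ Λs j
    later v∈ with j , v∈Λj ← ∈-concat-tabulate (Λs ∘ fsuc) v∈ = fsuc j , s≤s z≤n , v∈Λj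
  ... | inj₂ t≥ with u , refl ← m≤n⇒∃[o]m+o≡n t≥ = record
    { block  = fsuc block
    ; offset = offset
    ; prefix = λ v∈ → [ (λ v∈Λ₀ → inj₁ (fzero , s≤s z≤n , v∈Λ₀)) , Sum.map₁ shiftˡ ∘ prefix ]′
                        (∈-++⁻ (Λs fzero) (subst (_ ∈_) (take-++-+ u (Λs fzero) rest) v∈))
    ; suffix = λ v∈ → Sum.map₁ shiftʳ (suffix (subst (_ ∈_) (drop-++-+ u (Λs fzero) rest) v∈))
    }
    where
    rest : List X
    rest = concat (tabulate (Λs ∘ fsuc))
    open BlockCut (blockCut (Λs ∘ fsuc) u (subst (_ ∈_) (drop-++-+ u (Λs fzero) rest) w∈))
    shiftˡ : ∀ {v} → ∃[ j ] j <ᶠ block × v ∈ Λs (fsuc j) → ∃[ j ] j <ᶠ fsuc block × v ∈ Λs j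
    shiftˡ (j , j<i , v∈) = fsuc j , s≤s j<i , v∈
    shiftʳ : ∀ {v} → ∃[ j ] block <ᶠ j × v ∈ Λs (fsuc j) → ∃[ j ] fsuc block <ᶠ j × v ∈ Λs j
    shiftʳ (j , i<j , v∈) = fsuc j , s≤s i<j , v∈

length-filter-∁ : ∀ {A : Set} {P : Pred A 0ℓ} (P? : Decidable P) xs →
                  length (filter P? xs) + length (filter (∁? P?) xs) ≡ length xs
length-filter-∁ P? []       = refl
length-filter-∁ P? (x ∷ xs) with P? x
... | yes _ = cong suc (length-filter-∁ P? xs)
... | no  _ = trans (+-suc _ _) (cong suc (length-filter-∁ P? xs))

lookup-injective : ∀ {A : Set} {xs : List A} → Unique xs → ∀ p q → lookup xs p ≡ lookup xs q → p ≡ q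
lookup-injective {xs = x ∷ xs} _          fzero    fzero    _ = refl
lookup-injective {xs = x ∷ xs} (x∉ ∷ _)   fzero    (fsuc q) e = contradiction e (All.lookup x∉ (∈-lookup q))
lookup-injective {xs = x ∷ xs} (x∉ ∷ _)   (fsuc p) fzero    e = contradiction (sym e) (All.lookup x∉ (∈-lookup p))
lookup-injective {xs = x ∷ xs} (_ ∷ uniq) (fsuc p) (fsuc q) e = cong fsuc (lookup-injective uniq p q e)

module _ {A B : Set} (_≟_ : DecidableEquality B) (f : A → B) (d : ℕ) where

  length-≤-fibres : ∀ ps {xs : List A} → Unique xs → (∀ {x} → x ∈ xs → f x ∈ ps) →
                    (∀ {p ys} → p ∈ ps → Unique ys → All (λ y → f y ≡ p) ys → length ys ≤ d) →
                    length xs ≤ d * length ps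
  length-≤-fibres []       {[]}    _    _    _     = z≤n
  length-≤-fibres []       {_ ∷ _} _    into _     = contradiction (into (here refl)) λ ()
  length-≤-fibres (p ∷ ps) {xs}    uniq into fibre = begin
    length xs                                            ≡⟨ sym (length-filter-∁ at? xs) ⟩
    length (filter at? xs) + length (filter (∁? at?) xs) ≤⟨ +-mono-≤ at-p rest ⟩
    d + d * length ps                                    ≡⟨ sym (*-suc d (length ps)) ⟩
    d * suc (length ps)                                  ∎
    where
    open ≤-Reasoning
    at? : Decidable (λ x → f x ≡ p)
    at? x = f x ≟ p
    at-p : length (filter at? xs) ≤ d
    at-p = fibre (here refl) (filter⁺ at? uniq) (all-filter at? xs)
    into-ps : ∀ {x} → x ∈ filter (∁? at?) xs → f x ∈ ps
    into-ps x∈ with x∈xs , fx≢p ← ∈-filter⁻ (∁? at?) x∈ with into x∈xs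
    ... | here fx≡p   = contradiction fx≡p fx≢p
    ... | there fx∈ps = fx∈ps
    rest : length (filter (∁? at?) xs) ≤ d * length ps
    rest = length-≤-fibres ps (filter⁺ (∁? at?) uniq) into-ps (fibre ∘ there)

c+d*[w+w]≡2*d*w+c : ∀ c d w → c + d * (w + w) ≡ 2 * d * w + c
c+d*[w+w]≡2*d*w+c = solve-∀

∈⇒≤-foldr-⊔ : ∀ {x xs} → x ∈ xs → x ≤ foldr _⊔_ 0 xs
∈⇒≤-foldr-⊔ {xs = y ∷ xs} (here refl) = m≤m⊔n y _
∈⇒≤-foldr-⊔ {xs = y ∷ xs} (there x∈)  = ≤-trans (∈⇒≤-foldr-⊔ x∈) (m≤n⊔m y _)

submatching : ∀ {n} (G : Graph n) {A B A′ B′ : Fin n → Set} {m} {a b : Fin m → Fin n} →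
              IsInducedMatching G A B a b → ∀ {ks} → Unique ks →
              All (λ k → A′ (a k) × B′ (b k)) ks →
              IsInducedMatching G A′ B′ (a ∘ lookup ks) (b ∘ lookup ks)
submatching G M {ks} uniq sides = record
  { inA     = λ q → proj₁ (All.lookup sides (∈-lookup q))
  ; inB     = λ q → proj₂ (All.lookup sides (∈-lookup q))
  ; edge    = edge ∘ lookup ks
  ; induced = λ q q′ q≢q′ → induced _ _ (q≢q′ ∘ lookup-injective uniq q q′)
  }
  where open IsInducedMatching M

module _ {m} (H : Graph m) (Λ : List (Fin m)) where
  open DecMembership (_≟ᶠ_ {m}) using (_∈?_)

  Crosses : ℕ → Fin m × Fin m → Set
  Crosses s (u , v) = u ∈ take s Λ × (v ∈ drop s Λ × E H u v)

  crosses? : ∀ s → Decidable (Crosses s)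
  crosses? s p = (proj₁ p ∈? take s Λ) ×-dec ((proj₂ p ∈? drop s Λ) ×-dec E? H (proj₁ p) (proj₂ p))

  crossing : ℕ → List (Fin m × Fin m)
  crossing s = filter (crosses? s) (cartesianProduct (allFin m) (allFin m))

  ∈-crossing⁺ : ∀ {s u v} → u ∈ take s Λ → v ∈ drop s Λ → E H u v → (u , v) ∈ crossing s
  ∈-crossing⁺ {s} {u} {v} u∈ v∈ e =
    ∈-filter⁺ (crosses? s) (∈-cartesianProduct⁺ (∈-allFin u) (∈-allFin v)) (u∈ , v∈ , e)

  crossing-irrefl : ∀ {s p} → p ∈ crossing s → proj₁ p ≢ proj₂ p
  crossing-irrefl {s} p∈ refl with _ , _ , _ , e ← ∈-filter⁻ (crosses? s) {xs = cartesianProduct (allFin m) (allFin m)} p∈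
    = irrefl H e

  length-crossing≤cutw : ∀ {s} → s ≤ length Λ → length (crossing s) ≤ cutw H Λ
  length-crossing≤cutw s≤ = ∈⇒≤-foldr-⊔ (∈-map⁺ (crossingEdges H Λ) (∈-upTo⁺ (s≤s s≤)))

quotient-edge : ∀ {n r} (G : Graph n) (𝒫 : Partition n r) {u v} →
                part 𝒫 u ≢ part 𝒫 v → E G u v → E (quotient G 𝒫) (part 𝒫 u) (part 𝒫 v)
quotient-edge G 𝒫 {u} {v} ≢ e = ≢ , u , v , refl , refl , e

module Concatenation {n r : ℕ} (G : Graph n) (𝒫 : Partition n r) (c d : ℕ)
    (Λs : Fin r → List (Fin n))
    (orders : ∀ i → IsLinearOrderOf (Part 𝒫 i) (Λs i))
    (mimw : ∀ i → MimWidthLe G (Λs i) c)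
    (cutmim : ∀ i j → i ≢ j → CutmimLe G (Part 𝒫 i) (Part 𝒫 j) d) where

  Λ : List (Fin n)
  Λ = concat (tabulate Λs)

  G′ : Graph r
  G′ = quotient G 𝒫

  W : ℕ
  W = cutw G′ (allFin r)

  crossing′ : ℕ → List (Fin r × Fin r)
  crossing′ = crossing G′ (allFin r)

  length-crossing′≤W : ∀ {s} → s ≤ r → length (crossing′ s) ≤ W
  length-crossing′≤W s≤r = length-crossing≤cutw G′ (allFin r) (subst (_ ≤_) (sym (length-tabulate id)) s≤r)

  ∈Λs⇒part : ∀ {j v} → v ∈ Λs j → part 𝒫 v ≡ j
  ∈Λs⇒part {j} {v} = Equivalence.to (proj₂ (orders j) v)

  module Cut {t} (cut : BlockCut Λs t) where
    open BlockCut cut renaming (block to i; offset to t′)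

    prefix-part≤ : ∀ {v} → v ∈ take t Λ → part 𝒫 v ≤ᶠ i
    prefix-part≤ v∈ with prefix v∈
    ... | inj₁ (j , j<i , v∈Λj) rewrite ∈Λs⇒part v∈Λj = <⇒≤ j<i
    ... | inj₂ v∈′             = ≤-reflexive (cong toℕ (∈Λs⇒part (Any-resp-⊆ (take-⊆ t′ _) v∈′)))

    suffix-part≥ : ∀ {v} → v ∈ drop t Λ → i ≤ᶠ part 𝒫 v
    suffix-part≥ v∈ with suffix v∈
    ... | inj₁ (j , i<j , v∈Λj) rewrite ∈Λs⇒part v∈Λj = <⇒≤ i<j
    ... | inj₂ v∈′             = ≤-reflexive (cong toℕ (sym (∈Λs⇒part (Any-resp-⊆ (drop-⊆ t′ _) v∈′))))

    prefix-in-block : ∀ {v} → v ∈ take t Λ → part 𝒫 v ≡ i → v ∈ take t′ (Λs i)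
    prefix-in-block v∈ v∈Pᵢ with prefix v∈
    ... | inj₁ (j , j<i , v∈Λj) = contradiction (trans (sym (∈Λs⇒part v∈Λj)) v∈Pᵢ) (Fin.<⇒≢ j<i)
    ... | inj₂ v∈′             = v∈′

    suffix-in-block : ∀ {v} → v ∈ drop t Λ → part 𝒫 v ≡ i → v ∈ drop t′ (Λs i)
    suffix-in-block v∈ v∈Pᵢ with suffix v∈
    ... | inj₁ (j , i<j , v∈Λj) = contradiction (trans (sym v∈Pᵢ) (∈Λs⇒part v∈Λj)) (Fin.<⇒≢ i<j)
    ... | inj₂ v∈′             = v∈′

  module Matching {t m} {a b : Fin m → Fin n}
      (M : IsInducedMatching G (_∈ take t Λ) (_∈ drop t Λ) a b) (cut : BlockCut Λs t) where
    open IsInducedMatching M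
    open BlockCut cut renaming (block to i; offset to t′)
    open Cut cut

    pa pb : Fin m → Fin r
    pa = part 𝒫 ∘ a
    pb = part 𝒫 ∘ b

    Inside : Fin m → Set
    Inside k = pa k ≡ i × pb k ≡ i

    inside? : Decidable Inside
    inside? k = (pa k ≟ᶠ i) ×-dec (pb k ≟ᶠ i)

    inside-cut : ∀ {k} → Inside k → a k ∈ take t′ (Λs i) × b k ∈ drop t′ (Λs i)
    inside-cut {k} (pa≡i , pb≡i) = prefix-in-block (inA k) pa≡i , suffix-in-block (inB k) pb≡i

    inside-count : length (filter inside? (allFin m)) ≤ c
    inside-count = mimw i t′ _ _ _
      (submatching G M (filter⁺ inside? (allFin⁺ m)) (All.map inside-cut (all-filter inside? (allFin m))))

    pairs : List (Fin r × Fin r)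
    pairs = crossing′ (toℕ i) ++ crossing′ (suc (toℕ i))

    -- Outside Pᵢ × Pᵢ we have pa k < pb k, and the quotient edge crosses the
    -- cut before Pᵢ when pb k = i, and the cut after Pᵢ otherwise.
    outside-pairs : ∀ {k} → ¬ Inside k → (pa k , pb k) ∈ pairs
    outside-pairs {k} ¬inside with pb k ≟ᶠ i
    ... | yes pb≡i = ∈-++⁺ˡ (∈-crossing⁺ G′ (allFin r)
                       (∈-take-tabulate id (pa k) pa<i)
                       (∈-drop-tabulate id (pb k) (≤-reflexive (cong toℕ (sym pb≡i))))
                       (quotient-edge G 𝒫 (λ pa≡pb → ¬inside (trans pa≡pb pb≡i , pb≡i)) (edge k)))
      where
      pa<i : pa k <ᶠ i
      pa<i = Fin.≤∧≢⇒< (prefix-part≤ (inA k)) (λ pa≡i → ¬inside (pa≡i , pb≡i))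
    ... | no pb≢i = ∈-++⁺ʳ _ (∈-crossing⁺ G′ (allFin r)
                       (∈-take-tabulate id (pa k) (s≤s (prefix-part≤ (inA k))))
                       (∈-drop-tabulate id (pb k) i<pb)
                       (quotient-edge G 𝒫 (Fin.<⇒≢ (≤-<-trans (prefix-part≤ (inA k)) i<pb)) (edge k)))
      where
      i<pb : i <ᶠ pb k
      i<pb = Fin.≤∧≢⇒< (suffix-part≥ (inB k)) (pb≢i ∘ sym)

    fibre-count : ∀ {p ks} → p ∈ pairs → Unique ks → All (λ k → (pa k , pb k) ≡ p) ks → length ks ≤ d
    fibre-count {p} p∈ uniq at-p = cutmim (proj₁ p) (proj₂ p) p₁≢p₂ _ _ _
      (submatching G M uniq (All.map (λ e → cong proj₁ e , cong proj₂ e) at-p))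
      where
      p₁≢p₂ : proj₁ p ≢ proj₂ p
      p₁≢p₂ = [ crossing-irrefl G′ (allFin r) , crossing-irrefl G′ (allFin r) ]′ (∈-++⁻ _ p∈)

    outside-count : length (filter (∁? inside?) (allFin m)) ≤ d * length pairs
    outside-count = length-≤-fibres (≡-dec _≟ᶠ_ _≟ᶠ_) (λ k → pa k , pb k) d pairs
      (filter⁺ (∁? inside?) (allFin⁺ m))
      (outside-pairs ∘ proj₂ ∘ ∈-filter⁻ (∁? inside?) {xs = allFin m})
      fibre-count

    length-pairs≤2W : length pairs ≤ W + W
    length-pairs≤2W = begin
      length pairs                                             ≡⟨ length-++ (crossing′ (toℕ i)) ⟩
      length (crossing′ (toℕ i)) + length (crossing′ (suc (toℕ i)))
                                                               ≤⟨ +-mono-≤ (length-crossing′≤W (<⇒≤ (Fin.toℕ<n i)))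
                                                                           (length-crossing′≤W (Fin.toℕ<n i)) ⟩
      W + W                                                    ∎
      where open ≤-Reasoning

    matching-size : m ≤ 2 * d * W + c
    matching-size = begin
      m                                                     ≡⟨ sym (length-tabulate id) ⟩
      length (allFin m)                                     ≡⟨ sym (length-filter-∁ inside? (allFin m)) ⟩
      length (filter inside? (allFin m)) + length (filter (∁? inside?) (allFin m))
                                                            ≤⟨ +-mono-≤ inside-count outside-count ⟩
      c + d * length pairs                                  ≤⟨ +-monoʳ-≤ c (*-monoʳ-≤ d length-pairs≤2W) ⟩
      c + d * (W + W)                                       ≡⟨ c+d*[w+w]≡2*d*w+c c d W ⟩
      2 * d * W + c                                         ∎
      where open ≤-Reasoning

  mimwidth : MimWidthLe G Λ (2 * d * W + c)
  mimwidth t zero    _ _ _ = z≤n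
  mimwidth t (suc m) a b M = Matching.matching-size M (blockCut Λs t (IsInducedMatching.inB M fzero))

lemma22 : ∀ {n r : ℕ} (G : Graph n) (𝒫 : Partition n r) (c d : ℕ)
              (Λs : Fin r → List (Fin n)) →
              (∀ i → IsLinearOrderOf (Part 𝒫 i) (Λs i)) →
              (∀ i → MimWidthLe G (Λs i) c) →
              (∀ i j → i ≢ j → CutmimLe G (Part 𝒫 i) (Part 𝒫 j) d) →
              MimWidthLe G (concat (map Λs (allFin r)))
                (2 * d * cutw (quotient G 𝒫) (allFin r) + c)
lemma22 G 𝒫 c d Λs orders mimw cutmim =
  subst (λ Λ → MimWidthLe G (concat Λ) _) (sym (map-tabulate id Λs))
    (Concatenation.mimwidth G 𝒫 c d Λs orders mimw cutmim)
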